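{- If two digraphs $X$ and $Y$, each with $n$ vertices, satisfy $U_X=U_Y$, then for every $k\in[n]$ they have the same number of paths of length $k$. Consequently, their longest paths have the same length.
   Context: A digraph $X=(V,E)$ has a finite vertex set $V$, $|V|=n$, and $E\subseteq V\times V$. A path of length $k$ in $X$ is a sequence $(v_1,\dots,v_k)$ of $k$ distinct vertices with $(v_i,v_{i+1})\in E$ for all $i<k$. A $V$-listing is a bijection $\pi:[n]\to V$, and $X\mathrm{Des}(\pi)=\{i\in[n-1]:(\pi_i,\pi_{i+1})\in E\}$. Let $F_I=\sum_{i_1\le\dots\le i_n,\ i_j<i_{j+1}\ (j\in I)}x_{i_1}\cdots x_{i_n}$ for $I\subseteq[n-1]$. The Redei-Berge function is $U_X=\sum_\pi F_{X\mathrm{Des}(\pi)}$ over all $V$-listings. -}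

module Defs where

open import Data.Bool using (Bool; true; false; _∧_; not; if_then_else_)
open import Data.Nat using (ℕ; zero; suc; _≤_; _<ᵇ_; _⊔_)
open import Data.Fin using (Fin; _≟_)
open import Data.List using (List; []; _∷_; length; filterᵇ; concatMap; map; allFin)
open import Relation.Nullary.Decidable using (⌊_⌋)
open import Relation.Binary.PropositionalEquality using (_≡_)

-- A digraph on the vertex set V = Fin n, given by its (decidable) edge
-- relation: E u v = true  iff  (u , v) ∈ E.  Loops are allowed (E ⊆ V × V).
Digraph : ℕ → Set
Digraph n = Fin n → Fin n → Bool

seqs : {n : ℕ} → ℕ → List (List (Fin n))
seqs {n} zero    = [] ∷ []
seqs {n} (suc k) = concatMap (λ v → map (v ∷_) (seqs {n} k)) (allFin n)

elemᵇ : {n : ℕ} → Fin n → List (Fin n) → Bool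
elemᵇ v []       = false
elemᵇ v (w ∷ ws) = if ⌊ v ≟ w ⌋ then true else elemᵇ v ws

distinct : {n : ℕ} → List (Fin n) → Bool
distinct []       = true
distinct (v ∷ vs) = not (elemᵇ v vs) ∧ distinct vs

consecEdges : {n : ℕ} → Digraph n → List (Fin n) → Bool
consecEdges E []           = true
consecEdges E (v ∷ [])     = true
consecEdges E (v ∷ w ∷ vs) = E v w ∧ consecEdges E (w ∷ vs)

-- a path of length k: a sequence of k distinct vertices, consecutive ones adjacent
isPath : {n : ℕ} → Digraph n → List (Fin n) → Bool
isPath E p = distinct p ∧ consecEdges E p

pathCount : {n : ℕ} → Digraph n → ℕ → ℕ
pathCount X k = length (filterᵇ (isPath X) (seqs k))

-- V-listings: bijections [n] → V, i.e. sequences of length n of distinct vertices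
listings : (n : ℕ) → List (List (Fin n))
listings n = filterᵇ distinct (seqs {n} n)

-- Coefficient of the monomial x_{s_1} ⋯ x_{s_n} (s weakly increasing) in
-- F_{XDes(π)}: it is 1 iff s_i < s_{i+1} for every i ∈ XDes(π), i.e. for every
-- i with (π_i , π_{i+1}) ∈ E.
desCompatible : {n : ℕ} → Digraph n → List (Fin n) → List ℕ → Bool
desCompatible E (v ∷ w ∷ vs) (a ∷ b ∷ s) =
  (if E v w then a <ᵇ b else true) ∧ desCompatible E (w ∷ vs) (b ∷ s)
desCompatible E _ _ = true

-- Coefficient of the monomial x_{s_1} ⋯ x_{s_n} (s weakly increasing, of length n)
-- in the Redei–Berge function U_X = Σ_π F_{XDes(π)}.
UCoeff : {n : ℕ} → Digraph n → List ℕ → ℕ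
UCoeff {n} X s = length (filterᵇ (λ π → desCompatible X π s) (listings n))

-- U_X = U_Y as formal power series: equal coefficients of every monomial.
-- Monomials in the variables x_0, x_1, … are encoded by their weakly
-- increasing index sequence; U_X is homogeneous of degree n, so only
-- monomials of degree n can occur (all others have coefficient 0 in both).
data WeaklyIncr : List ℕ → Set where
  wi[]  : WeaklyIncr []
  wi[_] : (a : ℕ) → WeaklyIncr (a ∷ [])
  wi∷   : {a b : ℕ} {s : List ℕ} → a ≤ b → WeaklyIncr (b ∷ s) → WeaklyIncr (a ∷ b ∷ s)

SameU : {n : ℕ} → Digraph n → Digraph n → Set
SameU {n} X Y = (s : List ℕ) → length s ≡ n → WeaklyIncr s → UCoeff X s ≡ UCoeff Y s

longestUpTo : {n : ℕ} → Digraph n → ℕ → ℕ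
longestUpTo X zero    = zero
longestUpTo X (suc k) with pathCount X (suc k)
... | zero  = longestUpTo X k
... | suc _ = suc k

longestPath : {n : ℕ} → Digraph n → ℕ
longestPath {n} X = longestUpTo X n

-- Count the injective vertex sequences obeying a pattern that prescribes, for each consecutive pair,
-- "edge", "non-edge" or nothing. The coefficient of x_{s_1} ⋯ x_{s_n} in U_X is such a count for
-- listings: a step s_i = s_{i+1} forbids an edge at i, a step s_i < s_{i+1} allows anything. Since
-- "edge" = "anything" − "non-edge", U_X determines the count for every pattern of length n − 1.
-- Leaving the first n − k vertices free and asking the last k to form a path gives (n − k)! times
-- the number of k-paths, and the length of a longest path is read off from the path counts.

module Submission where

open import Defs
open import Data.Nat using (ℕ; _≤_)
open import Data.Product using (_×_)
open import Relation.Binary.PropositionalEquality using (_≡_)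

open import Data.Bool using (Bool; true; false; _∧_; not; if_then_else_)
open import Data.Bool.Properties using (∧-assoc; ∧-conicalˡ; ∧-conicalʳ; not-injective)
open import Data.Fin using (Fin; zero; suc; _≟_)
open import Data.List using (List; []; _∷_; _++_; length; map; concatMap; filterᵇ; allFin; replicate; tabulate)
open import Data.List.Properties
  using (map-++; map-cong; map-cong-local; map-∘; map-tabulate; length-++; length-replicate; length-tabulate)
open import Data.List.Relation.Unary.All using (All; []; _∷_)
import Data.List.Relation.Unary.All as All
open import Data.List.Relation.Unary.All.Properties using (concat⁺; map⁺; tabulate⁺)
open import Data.Nat using (zero; suc; _+_; _*_; _∸_; _<_; _<ᵇ_; z≤n; s≤s; NonZero; >-nonZero)
open import Data.Nat.Combinatorics.Base using (_P′_)
open import Data.Nat.ListAction using (sum)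
open import Data.Nat.ListAction.Properties using (sum-++)
open import Data.Nat.Properties hiding (_≟_)
open import Algebra.Properties.CommutativeSemigroup +-commutativeSemigroup using (interchange)
open import Data.Product using (_,_)
open import Function using (_∘_)
open import Relation.Binary.PropositionalEquality using (refl; sym; trans; cong; cong₂; subst; module ≡-Reasoning)
open import Relation.Nullary.Decidable using (⌊_⌋; yes; no; ⌊⌋-map′)

private
  variable
    A B : Set

𝟙 : Bool → ℕ
𝟙 true  = 1
𝟙 false = 0

𝟙-∧ : ∀ a b → 𝟙 (a ∧ b) ≡ 𝟙 a * 𝟙 b
𝟙-∧ true  b = sym (+-identityʳ (𝟙 b))
𝟙-∧ false b = refl

𝟙-cases : ∀ e b → 𝟙 b ≡ 𝟙 (e ∧ b) + 𝟙 (not e ∧ b)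
𝟙-cases true  b = sym (+-identityʳ (𝟙 b))
𝟙-cases false b = refl

𝟙-∧-+ : ∀ a {x y z} → 𝟙 x ≡ 𝟙 y + 𝟙 z → 𝟙 (a ∧ x) ≡ 𝟙 (a ∧ y) + 𝟙 (a ∧ z)
𝟙-∧-+ true  eq = eq
𝟙-∧-+ false _  = refl

sum-map-0 : (xs : List A) → sum (map (λ _ → 0) xs) ≡ 0
sum-map-0 []       = refl
sum-map-0 (_ ∷ xs) = sum-map-0 xs

sum-map-+ : (f g : A → ℕ) (xs : List A) →
            sum (map (λ x → f x + g x) xs) ≡ sum (map f xs) + sum (map g xs)
sum-map-+ f g []       = refl
sum-map-+ f g (x ∷ xs) = trans (cong (f x + g x +_) (sum-map-+ f g xs)) (interchange (f x) (g x) _ _)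

sum-map-*ˡ : (c : ℕ) (f : A → ℕ) (xs : List A) → sum (map (λ x → c * f x) xs) ≡ c * sum (map f xs)
sum-map-*ˡ c f []       = sym (*-zeroʳ c)
sum-map-*ˡ c f (x ∷ xs) = trans (cong (c * f x +_) (sum-map-*ˡ c f xs)) (sym (*-distribˡ-+ c (f x) _))

sum-map-*ʳ : (c : ℕ) (f : A → ℕ) (xs : List A) → sum (map (λ x → f x * c) xs) ≡ sum (map f xs) * c
sum-map-*ʳ c f []       = refl
sum-map-*ʳ c f (x ∷ xs) = trans (cong (f x * c +_) (sum-map-*ʳ c f xs)) (sym (*-distribʳ-+ c (f x) _))

sum-map-swap : (f : A → B → ℕ) (xs : List A) (ys : List B) →
               sum (map (λ x → sum (map (f x) ys)) xs) ≡ sum (map (λ y → sum (map (λ x → f x y) xs)) ys)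
sum-map-swap f []       ys = sym (sum-map-0 ys)
sum-map-swap f (x ∷ xs) ys = trans (cong (sum (map (f x) ys) +_) (sum-map-swap f xs ys))
                                   (sym (sum-map-+ (f x) _ ys))

count : (A → Bool) → List A → ℕ
count p xs = sum (map (𝟙 ∘ p) xs)

length-filterᵇ : (p : A → Bool) (xs : List A) → length (filterᵇ p xs) ≡ count p xs
length-filterᵇ p []       = refl
length-filterᵇ p (x ∷ xs) with p x
... | true  = cong suc (length-filterᵇ p xs)
... | false = length-filterᵇ p xs

count-filterᵇ : (p q : A → Bool) (xs : List A) → count p (filterᵇ q xs) ≡ count (λ x → q x ∧ p x) xs
count-filterᵇ p q []       = refl
count-filterᵇ p q (x ∷ xs) with q x
... | true  = cong (𝟙 (p x) +_) (count-filterᵇ p q xs)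
... | false = count-filterᵇ p q xs

count-cong : {p q : A → Bool} → (∀ x → p x ≡ q x) → (xs : List A) → count p xs ≡ count q xs
count-cong p≗q xs = cong sum (map-cong (cong 𝟙 ∘ p≗q) xs)

count-map : (p : B → Bool) (f : A → B) (xs : List A) → count p (map f xs) ≡ count (p ∘ f) xs
count-map p f xs = cong sum (sym (map-∘ xs))

count-concatMap : (p : B → Bool) (f : A → List B) (xs : List A) →
                  count p (concatMap f xs) ≡ sum (map (count p ∘ f) xs)
count-concatMap p f []       = refl
count-concatMap p f (x ∷ xs) = begin
  sum (map (𝟙 ∘ p) (f x ++ concatMap f xs))               ≡⟨ cong sum (map-++ (𝟙 ∘ p) (f x) _) ⟩
  sum (map (𝟙 ∘ p) (f x) ++ map (𝟙 ∘ p) (concatMap f xs)) ≡⟨ sum-++ (map (𝟙 ∘ p) (f x)) _ ⟩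
  count p (f x) + count p (concatMap f xs)                 ≡⟨ cong (count p (f x) +_) (count-concatMap p f xs) ⟩
  count p (f x) + sum (map (count p ∘ f) xs)               ∎
  where open ≡-Reasoning

count-not+count : (p : A → Bool) (xs : List A) → count (not ∘ p) xs + count p xs ≡ length xs
count-not+count p []       = refl
count-not+count p (x ∷ xs) with p x
... | true  = trans (+-suc (count (not ∘ p) xs) (count p xs)) (cong suc (count-not+count p xs))
... | false = cong suc (count-not+count p xs)

count-not : (p : A → Bool) (xs : List A) → count (not ∘ p) xs ≡ length xs ∸ count p xs
count-not p xs = trans (sym (m+n∸n≡m _ (count p xs))) (cong (_∸ count p xs) (count-not+count p xs))

count-allFin-suc : ∀ {n} (p : Fin (suc n) → Bool) →
                   count p (allFin (suc n)) ≡ 𝟙 (p zero) + count (p ∘ suc) (allFin n)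
count-allFin-suc {n} p = cong (𝟙 (p zero) +_) (begin
  count p (tabulate suc)       ≡⟨ cong (count p) (map-tabulate (λ i → i) suc) ⟨
  count p (map suc (allFin n)) ≡⟨ count-map p suc (allFin n) ⟩
  count (p ∘ suc) (allFin n)   ∎)
  where open ≡-Reasoning

count-≟ : ∀ {n} (u : Fin n) → count (λ v → ⌊ v ≟ u ⌋) (allFin n) ≡ 1
count-≟ {suc n} zero    = trans (count-allFin-suc {n} (λ v → ⌊ v ≟ zero ⌋)) (cong suc (sum-map-0 (allFin n)))
count-≟ {suc n} (suc u) = begin
  count (λ v → ⌊ v ≟ suc u ⌋) (allFin (suc n)) ≡⟨ count-allFin-suc (λ v → ⌊ v ≟ suc u ⌋) ⟩
  count (λ v → ⌊ suc v ≟ suc u ⌋) (allFin n)   ≡⟨ count-cong (λ v → ⌊⌋-map′ _ _ (v ≟ u)) (allFin n) ⟩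
  count (λ v → ⌊ v ≟ u ⌋) (allFin n)           ≡⟨ count-≟ u ⟩
  1                                             ∎
  where open ≡-Reasoning

𝟙-elemᵇ-∷ : ∀ {n} (v u : Fin n) (w : List (Fin n)) → elemᵇ u w ≡ false →
            𝟙 (elemᵇ v (u ∷ w)) ≡ 𝟙 ⌊ v ≟ u ⌋ + 𝟙 (elemᵇ v w)
𝟙-elemᵇ-∷ v u w u∉w with v ≟ u
... | yes refl = cong (suc ∘ 𝟙) (sym u∉w)
... | no  _    = refl

count-elemᵇ : ∀ {n} (w : List (Fin n)) → distinct w ≡ true → count (λ v → elemᵇ v w) (allFin n) ≡ length w
count-elemᵇ {n} []      _ = sum-map-0 (allFin n)
count-elemᵇ {n} (u ∷ w) d = begin
  count (λ v → elemᵇ v (u ∷ w)) (allFin n)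
    ≡⟨ cong sum (map-cong (λ v → 𝟙-elemᵇ-∷ v u w u∉w) (allFin n)) ⟩
  sum (map (λ v → 𝟙 ⌊ v ≟ u ⌋ + 𝟙 (elemᵇ v w)) (allFin n))
    ≡⟨ sum-map-+ (λ v → 𝟙 ⌊ v ≟ u ⌋) (λ v → 𝟙 (elemᵇ v w)) (allFin n) ⟩
  count (λ v → ⌊ v ≟ u ⌋) (allFin n) + count (λ v → elemᵇ v w) (allFin n)
    ≡⟨ cong₂ _+_ (count-≟ u) (count-elemᵇ w (∧-conicalʳ _ _ d)) ⟩
  suc (length w) ∎
  where
  open ≡-Reasoning
  u∉w : elemᵇ u w ≡ false
  u∉w = not-injective (∧-conicalˡ _ _ d)

count-fresh : ∀ {n} (w : List (Fin n)) → distinct w ≡ true →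
              count (λ v → not (elemᵇ v w)) (allFin n) ≡ n ∸ length w
count-fresh {n} w d = begin
  count (λ v → not (elemᵇ v w)) (allFin n)
    ≡⟨ count-not (λ v → elemᵇ v w) (allFin n) ⟩
  length (allFin n) ∸ count (λ v → elemᵇ v w) (allFin n)
    ≡⟨ cong₂ _∸_ (length-tabulate (λ i → i)) (count-elemᵇ w d) ⟩
  n ∸ length w ∎
  where open ≡-Reasoning

seqs-length : ∀ {n} m → All (λ w → length w ≡ m) (seqs {n} m)
seqs-length zero    = refl ∷ []
seqs-length {n} (suc m) =
  concat⁺ (map⁺ (tabulate⁺ {n = n} λ v → map⁺ {f = v ∷_} (All.map (cong suc) (seqs-length m))))

sum-seqs-cong : ∀ {n m} {f g : List (Fin n) → ℕ} → (∀ w → length w ≡ m → f w ≡ g w) →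
                sum (map f (seqs m)) ≡ sum (map g (seqs m))
sum-seqs-cong {m = m} f≗g = cong sum (map-cong-local (All.map (f≗g _) (seqs-length m)))

data Constraint : Set where
  free edge nonEdge : Constraint

allows : Constraint → Bool → Bool
allows free    _ = true
allows edge    e = e
allows nonEdge e = not e

satisfies : ∀ {n} → Digraph n → List Constraint → List (Fin n) → Bool
satisfies X (c ∷ t) (v ∷ w ∷ vs) = allows c (X v w) ∧ satisfies X t (w ∷ vs)
satisfies X _       _            = true

patternCount : ∀ {n} → Digraph n → ℕ → List Constraint → ℕ
patternCount X m t = count (λ w → distinct w ∧ satisfies X t w) (seqs m)

satisfies-free∷ : ∀ {n} (X : Digraph n) t v w → satisfies X (free ∷ t) (v ∷ w) ≡ satisfies X t w
satisfies-free∷ X []      v []      = refl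
satisfies-free∷ X (_ ∷ _) v []      = refl
satisfies-free∷ X t       v (_ ∷ _) = refl

𝟙-fresh∷ : ∀ {n} (X : Digraph n) t v w →
           𝟙 (distinct (v ∷ w) ∧ satisfies X (free ∷ t) (v ∷ w))
           ≡ 𝟙 (not (elemᵇ v w)) * 𝟙 (distinct w ∧ satisfies X t w)
𝟙-fresh∷ X t v w rewrite satisfies-free∷ X t v w | ∧-assoc (not (elemᵇ v w)) (distinct w) (satisfies X t w) =
  𝟙-∧ (not (elemᵇ v w)) _

count-fresh-*-𝟙-distinct : ∀ {n m} (w : List (Fin n)) (b : Bool) → length w ≡ m →
                count (λ v → not (elemᵇ v w)) (allFin n) * 𝟙 (distinct w ∧ b) ≡ (n ∸ m) * 𝟙 (distinct w ∧ b)
count-fresh-*-𝟙-distinct {n} w b refl with distinct w in d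
... | true  = cong (_* 𝟙 b) (count-fresh w d)
... | false = trans (*-zeroʳ (count (λ v → not (elemᵇ v w)) (allFin n))) (sym (*-zeroʳ (n ∸ length w)))

-- Prepending a free vertex: it can be any of the n ∸ m vertices not yet used.
patternCount-free∷ : ∀ {n} (X : Digraph n) m t → patternCount X (suc m) (free ∷ t) ≡ (n ∸ m) * patternCount X m t
patternCount-free∷ {n} X m t = begin
  count okFree (concatMap (λ v → map (v ∷_) (seqs m)) (allFin n))
    ≡⟨ count-concatMap okFree (λ v → map (v ∷_) (seqs m)) (allFin n) ⟩
  sum (map (λ v → count okFree (map (v ∷_) (seqs m))) (allFin n))
    ≡⟨ cong sum (map-cong (λ v → trans (count-map okFree (v ∷_) (seqs m))
                                       (cong sum (map-cong (𝟙-fresh∷ X t v) (seqs m)))) (allFin n)) ⟩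
  sum (map (λ v → sum (map (λ w → 𝟙 (not (elemᵇ v w)) * 𝟙 (ok w)) (seqs m))) (allFin n))
    ≡⟨ sum-map-swap (λ v w → 𝟙 (not (elemᵇ v w)) * 𝟙 (ok w)) (allFin n) (seqs m) ⟩
  sum (map (λ w → sum (map (λ v → 𝟙 (not (elemᵇ v w)) * 𝟙 (ok w)) (allFin n))) (seqs m))
    ≡⟨ sum-seqs-cong {m = m} (λ w len → trans (sum-map-*ʳ (𝟙 (ok w)) (λ v → 𝟙 (not (elemᵇ v w))) (allFin n))
                                      (count-fresh-*-𝟙-distinct w (satisfies X t w) len)) ⟩
  sum (map (λ w → (n ∸ m) * 𝟙 (ok w)) (seqs m))
    ≡⟨ sum-map-*ˡ (n ∸ m) (𝟙 ∘ ok) (seqs m) ⟩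
  (n ∸ m) * patternCount X m t ∎
  where
  open ≡-Reasoning
  ok okFree : List (Fin n) → Bool
  ok     w = distinct w ∧ satisfies X t w
  okFree w = distinct w ∧ satisfies X (free ∷ t) w

patternCount-frees : ∀ {n} (X : Digraph n) j m t →
                     patternCount X (j + m) (replicate j free ++ t) ≡ ((n ∸ m) P′ j) * patternCount X m t
patternCount-frees     X zero    m t = sym (*-identityˡ (patternCount X m t))
patternCount-frees {n} X (suc j) m t = begin
  patternCount X (suc (j + m)) (free ∷ replicate j free ++ t)   ≡⟨ patternCount-free∷ X (j + m) _ ⟩
  (n ∸ (j + m)) * patternCount X (j + m) (replicate j free ++ t) ≡⟨ cong₂ _*_ n∸[j+m] (patternCount-frees X j m t) ⟩
  (n ∸ m ∸ j) * (((n ∸ m) P′ j) * patternCount X m t)           ≡⟨ *-assoc (n ∸ m ∸ j) _ _ ⟨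
  ((n ∸ m) P′ suc j) * patternCount X m t                        ∎
  where
  open ≡-Reasoning
  n∸[j+m] : n ∸ (j + m) ≡ n ∸ m ∸ j
  n∸[j+m] = trans (cong (n ∸_) (+-comm j m)) (sym (∸-+-assoc n m j))

𝟙-satisfies-split : ∀ {n} (X : Digraph n) P t (w : List (Fin n)) → suc (length P) < length w →
  𝟙 (satisfies X (P ++ free ∷ t) w) ≡ 𝟙 (satisfies X (P ++ edge ∷ t) w) + 𝟙 (satisfies X (P ++ nonEdge ∷ t) w)
𝟙-satisfies-split X []      t (v ∷ [])    (s≤s ())
𝟙-satisfies-split X []      t (v ∷ u ∷ w) _         = 𝟙-cases (X v u) (satisfies X t (u ∷ w))
𝟙-satisfies-split X (c ∷ P) t (v ∷ u ∷ w) (s≤s len) = 𝟙-∧-+ (allows c (X v u)) (𝟙-satisfies-split X P t (u ∷ w) len)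

patternCount-split : ∀ {n} (X : Digraph n) m P t → suc (length P) < m →
  patternCount X m (P ++ free ∷ t) ≡ patternCount X m (P ++ edge ∷ t) + patternCount X m (P ++ nonEdge ∷ t)
patternCount-split X m P t len = begin
  patternCount X m (P ++ free ∷ t)
    ≡⟨ sum-seqs-cong {m = m} (λ w len-w → 𝟙-∧-+ (distinct w)
                               (𝟙-satisfies-split X P t w (subst (suc (length P) <_) (sym len-w) len))) ⟩
  sum (map (λ w → 𝟙 (ok (P ++ edge ∷ t) w) + 𝟙 (ok (P ++ nonEdge ∷ t) w)) (seqs m))
    ≡⟨ sum-map-+ (𝟙 ∘ ok (P ++ edge ∷ t)) (𝟙 ∘ ok (P ++ nonEdge ∷ t)) (seqs m) ⟩
  patternCount X m (P ++ edge ∷ t) + patternCount X m (P ++ nonEdge ∷ t) ∎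
  where
  open ≡-Reasoning
  ok : List Constraint → List (Fin _) → Bool
  ok t′ w = distinct w ∧ satisfies X t′ w

satisfies-edges : ∀ {n} (X : Digraph n) k (w : List (Fin n)) → length w ≡ suc k →
                  satisfies X (replicate k edge) w ≡ consecEdges X w
satisfies-edges X zero    (v ∷ [])    _   = refl
satisfies-edges X (suc k) (v ∷ u ∷ w) len = cong (X v u ∧_) (satisfies-edges X k (u ∷ w) (suc-injective len))

pathCount≡patternCount : ∀ {n} (X : Digraph n) k → pathCount X (suc k) ≡ patternCount X (suc k) (replicate k edge)
pathCount≡patternCount X k = trans (length-filterᵇ (isPath X) (seqs (suc k)))
  (sum-seqs-cong {m = suc k} (λ w len → cong (𝟙 ∘ (distinct w ∧_)) (sym (satisfies-edges X k w len))))

-- A monomial x_{s₀} x_{s₁} ⋯ of U_X, with s weakly increasing, is encoded by s₀ = a and the list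
-- recording which of the steps s_i ≤ s_{i+1} are strict.
staircase : ℕ → List Bool → List ℕ
staircase a []           = []
staircase a (true ∷ bs)  = suc a ∷ staircase (suc a) bs
staircase a (false ∷ bs) = a ∷ staircase a bs

staircase-weaklyIncr : ∀ a bs → WeaklyIncr (a ∷ staircase a bs)
staircase-weaklyIncr a []           = wi[ a ]
staircase-weaklyIncr a (true ∷ bs)  = wi∷ (n≤1+n a) (staircase-weaklyIncr (suc a) bs)
staircase-weaklyIncr a (false ∷ bs) = wi∷ ≤-refl (staircase-weaklyIncr a bs)

length-staircase : ∀ a bs → length (staircase a bs) ≡ length bs
length-staircase a []           = refl
length-staircase a (true ∷ bs)  = cong suc (length-staircase (suc a) bs)
length-staircase a (false ∷ bs) = cong suc (length-staircase a bs)

ascentConstraint : Bool → Constraint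
ascentConstraint true  = free
ascentConstraint false = nonEdge

-- A strict step s_i < s_{i+1} is compatible with a descent at i, an equality s_i = s_{i+1} forbids one.
if-<ᵇ-suc : ∀ e a → (if e then a <ᵇ suc a else true) ≡ true
if-<ᵇ-suc true  zero    = refl
if-<ᵇ-suc true  (suc a) = if-<ᵇ-suc true a
if-<ᵇ-suc false _       = refl

if-<ᵇ-refl : ∀ e a → (if e then a <ᵇ a else true) ≡ not e
if-<ᵇ-refl true  zero    = refl
if-<ᵇ-refl true  (suc a) = if-<ᵇ-refl true a
if-<ᵇ-refl false _       = refl

desCompatible-staircase : ∀ {n} (X : Digraph n) a bs π →
  desCompatible X π (a ∷ staircase a bs) ≡ satisfies X (map ascentConstraint bs) π
desCompatible-staircase X a []           []          = refl
desCompatible-staircase X a []           (_ ∷ [])    = refl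
desCompatible-staircase X a []           (_ ∷ _ ∷ _) = refl
desCompatible-staircase X a (_ ∷ _)      []          = refl
desCompatible-staircase X a (_ ∷ _)      (_ ∷ [])    = refl
desCompatible-staircase X a (true ∷ bs)  (v ∷ u ∷ π) =
  cong₂ _∧_ (if-<ᵇ-suc (X v u) a) (desCompatible-staircase X (suc a) bs (u ∷ π))
desCompatible-staircase X a (false ∷ bs) (v ∷ u ∷ π) =
  cong₂ _∧_ (if-<ᵇ-refl (X v u) a) (desCompatible-staircase X a bs (u ∷ π))

UCoeff-staircase : ∀ {n} (X : Digraph n) bs →
                   UCoeff X (0 ∷ staircase 0 bs) ≡ patternCount X n (map ascentConstraint bs)
UCoeff-staircase {n} X bs = begin
  length (filterᵇ desCompat (filterᵇ distinct (seqs n)))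
    ≡⟨ length-filterᵇ desCompat (filterᵇ distinct (seqs n)) ⟩
  count desCompat (filterᵇ distinct (seqs n))
    ≡⟨ count-filterᵇ desCompat distinct (seqs n) ⟩
  count (λ π → distinct π ∧ desCompat π) (seqs n)
    ≡⟨ count-cong (λ π → cong (distinct π ∧_) (desCompatible-staircase X 0 bs π)) (seqs n) ⟩
  patternCount X n (map ascentConstraint bs) ∎
  where
  open ≡-Reasoning
  desCompat : List (Fin n) → Bool
  desCompat π = desCompatible X π (0 ∷ staircase 0 bs)

SplitsBelow : ℕ → (List Constraint → ℕ) → Set
SplitsBelow L f = ∀ P t → length P < L → f (P ++ free ∷ t) ≡ f (P ++ edge ∷ t) + f (P ++ nonEdge ∷ t)

-- Inclusion–exclusion: an edge constraint is a free one minus a non-edge one, so removing the edge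
-- constraints one at a time (from the left) reduces everything to patterns without them.
agreeWithoutEdges⇒agree : ∀ L (f g : List Constraint → ℕ) → SplitsBelow L f → SplitsBelow L g →
  (∀ bs → length bs ≡ L → f (map ascentConstraint bs) ≡ g (map ascentConstraint bs)) →
  ∀ t → length t ≡ L → f t ≡ g t
agreeWithoutEdges⇒agree zero    f g _       _       f≡g []      _   = f≡g [] refl
agreeWithoutEdges⇒agree (suc L) f g f-split g-split f≡g (c ∷ t) len = agreeAt c
  where
  open ≡-Reasoning
  agreeAfter : ∀ b → f (ascentConstraint b ∷ t) ≡ g (ascentConstraint b ∷ t)
  agreeAfter b = agreeWithoutEdges⇒agree L (f ∘ (ascentConstraint b ∷_)) (g ∘ (ascentConstraint b ∷_))
    (λ P t′ P<L → f-split (_ ∷ P) t′ (s≤s P<L)) (λ P t′ P<L → g-split (_ ∷ P) t′ (s≤s P<L))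
    (λ bs len′ → f≡g (b ∷ bs) (cong suc len′)) t (suc-injective len)
  agreeAt : ∀ c → f (c ∷ t) ≡ g (c ∷ t)
  agreeAt free    = agreeAfter true
  agreeAt nonEdge = agreeAfter false
  agreeAt edge    = +-cancelʳ-≡ (f (nonEdge ∷ t)) _ _ (begin
    f (edge ∷ t) + f (nonEdge ∷ t) ≡⟨ f-split [] t (s≤s z≤n) ⟨
    f (free ∷ t)                   ≡⟨ agreeAfter true ⟩
    g (free ∷ t)                   ≡⟨ g-split [] t (s≤s z≤n) ⟩
    g (edge ∷ t) + g (nonEdge ∷ t) ≡⟨ cong (g (edge ∷ t) +_) (agreeAfter false) ⟨
    g (edge ∷ t) + f (nonEdge ∷ t) ∎)

sameU⇒samePatternCount : ∀ {n} {X Y : Digraph n} → SameU X Y →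
                         ∀ t → suc (length t) ≡ n → patternCount X n t ≡ patternCount Y n t
sameU⇒samePatternCount {suc L} {X} {Y} same t len =
  agreeWithoutEdges⇒agree L (patternCount X (suc L)) (patternCount Y (suc L))
    (λ P t′ P<L → patternCount-split X (suc L) P t′ (s≤s P<L))
    (λ P t′ P<L → patternCount-split Y (suc L) P t′ (s≤s P<L))
    agreeOnMonomials t (suc-injective len)
  where
  open ≡-Reasoning
  agreeOnMonomials : ∀ bs → length bs ≡ L →
                     patternCount X (suc L) (map ascentConstraint bs)
                     ≡ patternCount Y (suc L) (map ascentConstraint bs)
  agreeOnMonomials bs len′ = begin
    patternCount X (suc L) (map ascentConstraint bs) ≡⟨ UCoeff-staircase X bs ⟨
    UCoeff X (0 ∷ staircase 0 bs)                    ≡⟨ same (0 ∷ staircase 0 bs)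
                                                             (cong suc (trans (length-staircase 0 bs) len′))
                                                             (staircase-weaklyIncr 0 bs) ⟩
    UCoeff Y (0 ∷ staircase 0 bs)                    ≡⟨ UCoeff-staircase Y bs ⟩
    patternCount Y (suc L) (map ascentConstraint bs) ∎

P′-nonZero : ∀ {n k} → k ≤ n → NonZero (n P′ k)
P′-nonZero {k = zero}      _   = _
P′-nonZero {n} {k = suc k} k<n = m*n≢0 (n ∸ k) (n P′ k) {{>-nonZero (m<n⇒0<n∸m k<n)}} {{P′-nonZero (<⇒≤ k<n)}}

-- Listings whose last k + 1 vertices form a path, the first j = n ∸ (k + 1) being arbitrary;
-- the factor j P′ j is j!.
pathCount-scaled : ∀ {n} (X : Digraph n) j k → j + suc k ≡ n →
                   (j P′ j) * pathCount X (suc k) ≡ patternCount X n (replicate j free ++ replicate k edge)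
pathCount-scaled X j k refl = begin
  (j P′ j) * pathCount X (suc k)
    ≡⟨ cong ((j P′ j) *_) (pathCount≡patternCount X k) ⟩
  (j P′ j) * paths
    ≡⟨ cong (λ i → (i P′ j) * paths) (m+n∸n≡m j (suc k)) ⟨
  ((j + suc k ∸ suc k) P′ j) * paths
    ≡⟨ patternCount-frees X j (suc k) (replicate k edge) ⟨
  patternCount X (j + suc k) (replicate j free ++ replicate k edge) ∎
  where
  open ≡-Reasoning
  paths : ℕ
  paths = patternCount X (suc k) (replicate k edge)

sameU⇒samePathCount : ∀ {n} {X Y : Digraph n} → SameU X Y → ∀ k → 1 ≤ k → k ≤ n → pathCount X k ≡ pathCount Y k
sameU⇒samePathCount {n} {X} {Y} same (suc k) _ k<n =
  *-cancelˡ-≡ _ _ (j P′ j) {{P′-nonZero {j} ≤-refl}} (begin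
    (j P′ j) * pathCount X (suc k) ≡⟨ pathCount-scaled X j k j+k≡n ⟩
    patternCount X n T             ≡⟨ sameU⇒samePatternCount same T lenT ⟩
    patternCount Y n T             ≡⟨ pathCount-scaled Y j k j+k≡n ⟨
    (j P′ j) * pathCount Y (suc k) ∎)
  where
  open ≡-Reasoning
  j = n ∸ suc k
  T = replicate j free ++ replicate k edge
  j+k≡n : j + suc k ≡ n
  j+k≡n = m∸n+n≡m k<n
  lenT : suc (length T) ≡ n
  lenT = begin
    suc (length T)
      ≡⟨ cong suc (length-++ (replicate j free)) ⟩
    suc (length (replicate j free) + length (replicate k edge))
      ≡⟨ cong₂ (λ a b → suc (a + b)) (length-replicate j) (length-replicate k) ⟩
    suc (j + k)
      ≡⟨ +-suc j k ⟨
    j + suc k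
      ≡⟨ j+k≡n ⟩
    n ∎

longestUpTo-cong : ∀ {n} {X Y : Digraph n} m → (∀ k → 1 ≤ k → k ≤ m → pathCount X k ≡ pathCount Y k) →
                   longestUpTo X m ≡ longestUpTo Y m
longestUpTo-cong zero _ = refl
longestUpTo-cong {X = X} {Y} (suc m) same
  with pathCount X (suc m) | pathCount Y (suc m) | same (suc m) (s≤s z≤n) ≤-refl
... | zero  | .zero    | refl = longestUpTo-cong m (λ k 1≤k k≤m → same k 1≤k (m≤n⇒m≤1+n k≤m))
... | suc _ | .(suc _) | refl = refl

mainTheorem11 : (n : ℕ) (X Y : Digraph n) → SameU X Y →
    ((k : ℕ) → 1 ≤ k → k ≤ n → pathCount X k ≡ pathCount Y k)
    × (longestPath X ≡ longestPath Y)
mainTheorem11 n X Y same = sameU⇒samePathCount same , longestUpTo-cong n (sameU⇒samePathCount same)
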